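{- Let $n\ge1$ and $C\in DC(n)$. Let $\phi(C)\in\mathfrak{S}_{2n+2}$ be the permutation whose inverse is the word $$2\; e_{i_2(1)}\, e_{i_1(1)}\; e_{i_2(2)}\, e_{i_1(2)}\;\cdots\; e_{i_2(n)}\, e_{i_1(n)}\;(2n+1),$$ i.e. $\phi(C)^{ -1}(1)=2$, $\phi(C)^{ -1}(2j)=e_{i_2(j)}$, $\phi(C)^{ -1}(2j+1)=e_{i_1(j)}$ for $j\in[n]$, and $\phi(C)^{ -1}(2n+2)=2n+1$. Then $\phi(C)$ is a normalized Dumont permutation of order $2n+2$, i.e. $\phi(C)\in\mathfrak{D}_{n+1}'$.
   Context: A Dellac configuration of size $n$ is a placement of $2n$ dots in a grid with $n$ columns (indexed $1..n$ left to right) and $2n$ rows (indexed $1..2n$ bottom to top) such that each row contains exactly one dot, each column exactly two dots, and each dot in column $j$, row $i$ satisfies $j\le i\le j+n$; $DC(n)$ is their set. Labels: for $i\in[n]$ the dot in row $i$ is labeled $e_i=2i+2$ and the dot in row $n+i$ is labeled $e_{n+i}=2i-1$. For $j\in[n]$, $i_1(j)<i_2(j)$ are the row indices of the two dots of column $j$. A Dumont permutation of order $2m$ is $\sigma\in\mathfrak{S}_{2m}$ with $\sigma(2i)<2i$ and $\sigma(2i-1)>2i-1$ for all $i\in[m]$ (set $\mathfrak{D}_m$); it is normalized if for every $j\in[m-1]$, $\sigma^{ -1}(2j)$ and $\sigma^{ -1}(2j+1)$ have the same parity iff $\sigma^{ -1}(2j)>\sigma^{ -1}(2j+1)$ (set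 $\mathfrak{D}_m'$). -}

module Defs where

open import Data.Nat using (ℕ; zero; suc; _+_; _*_; _∸_; _≤_; _<_; _≤ᵇ_; _≡ᵇ_)
open import Data.Nat.Properties using (_≟_; _<?_)
open import Data.Nat.DivMod using (_/_; _%_)
open import Data.Bool using (if_then_else_)
open import Data.Fin using (Fin; toℕ; fromℕ<)
open import Data.List using (List; []; _∷_; map; filter; length; allFin)
open import Data.Product using (_×_)
open import Function.Bundles using (_⇔_)
open import Relation.Binary.PropositionalEquality using (_≡_)
open import Relation.Nullary using (yes; no)
open import Data.Fin.Permutation using (Permutation′; _⟨$⟩ʳ_; _⟨$⟩ˡ_)

-- Rows are Fin (2 * n) (row r is row
-- toℕ r + 1 in the paper), columns are Fin n (column c is toℕ c + 1).
-- Each row contains exactly one dot: encoded by a function row ↦ column.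
record DC (n : ℕ) : Set where
  field
    col      : Fin (2 * n) → Fin n
    bounds   : ∀ (r : Fin (2 * n)) →
               suc (toℕ (col r)) ≤ suc (toℕ r) × suc (toℕ r) ≤ suc (toℕ (col r)) + n
    twoDots  : ∀ (c : Fin n) →
               length (filter (λ r → toℕ (col r) ≟ toℕ c) (allFin (2 * n))) ≡ 2
open DC public

-- the (1-indexed) rows of the dots in column j (1-indexed), increasing
rowsOf : ∀ {n} → DC n → ℕ → List ℕ
rowsOf C j = map (λ r → suc (toℕ r))
                 (filter (λ r → suc (toℕ (col C r)) ≟ j) (allFin _))

nthOr0 : ℕ → List ℕ → ℕ
nthOr0 _       []       = 0
nthOr0 zero    (x ∷ _)  = x
nthOr0 (suc k) (_ ∷ xs) = nthOr0 k xs

i₁ i₂ : ∀ {n} → DC n → ℕ → ℕ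
i₁ C j = nthOr0 0 (rowsOf C j)
i₂ C j = nthOr0 1 (rowsOf C j)

-- labels: e_i = 2i+2 for i ∈ [n], e_{n+i} = 2i-1 for i ∈ [n]
label : ℕ → ℕ → ℕ
label n i = if i ≤ᵇ n then 2 * i + 2 else 2 * (i ∸ n) ∸ 1

-- the word φ(C)^{-1}, as a function of positions 1 .. 2n+2
phiInvWord : ∀ {n} → DC n → ℕ → ℕ
phiInvWord {n} C k =
  if k ≡ᵇ 1 then 2
  else if k ≡ᵇ 2 * suc n then 2 * n + 1
  else if k % 2 ≡ᵇ 0 then label n (i₂ C (k / 2))
  else label n (i₁ C (k / 2))

-- a function on Fin N viewed as a function on 1-indexed naturals
-- (value 0 outside 1 .. N)
at : ∀ {N} → (Fin N → Fin N) → ℕ → ℕ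
at {N} f k with k ∸ 1 <? N
... | yes p = suc (toℕ (f (fromℕ< p)))
... | no _  = 0

-- σ(k) and σ^{-1}(k), 1-indexed
app appInv : ∀ {N} → Permutation′ N → ℕ → ℕ
app    σ = at (σ ⟨$⟩ʳ_)
appInv σ = at (σ ⟨$⟩ˡ_)

IsDumont : (m : ℕ) → Permutation′ (2 * m) → Set
IsDumont m σ = ∀ i → 1 ≤ i → i ≤ m →
  app σ (2 * i) < 2 * i × 2 * i ∸ 1 < app σ (2 * i ∸ 1)

IsNormalizedDumont : (m : ℕ) → Permutation′ (2 * m) → Set
IsNormalizedDumont m σ = IsDumont m σ ×
  (∀ j → 1 ≤ j → j ≤ m ∸ 1 →
     ((appInv σ (2 * j) % 2 ≡ appInv σ (2 * j + 1) % 2)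
        ⇔ (appInv σ (2 * j + 1) < appInv σ (2 * j))))

module Submission where

-- Complete C by two virtual dots, in row 0 of column 0 and in row 2n + 1 of column
-- n + 1; as label 0 = 2 and label (2n + 1) = 2n + 1, the word then reads at
-- position 2c or 2c + 1 the label of a dot of column c.  Three facts follow from
-- the labelling and the Dellac condition c ≤ r ≤ c + n on a dot (c, r):
--  * labels are injective and a row determines its column, so the word is
--    injective, hence (by finiteness) the inverse of a permutation;
--  * a dot of column c has an even label above 2c + 1 or an odd label below 2c,
--    so every letter lies on the Dumont side of its position: φ(C) is Dumont;
--  * the two dots of a column have labels of equal parity exactly when the labels
--    increase, which is the normalization condition.

open import Defs
open import Data.Nat using (ℕ; zero; suc; _+_; _*_; _∸_; _≤_; _<_; _≡ᵇ_; z≤n; s≤s; s≤s⁻¹)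
open import Data.Nat.Properties
open import Data.Nat.DivMod using (_%_; _/_; m*n%n≡0; [m+kn]%n≡m%n; m*n/n≡m; +-distrib-/)
open import Data.Fin as Fin using (Fin; toℕ; fromℕ<; punchOut)
open import Data.Fin.Properties
  using (toℕ-injective; toℕ-fromℕ<; fromℕ<-toℕ; toℕ<n; any?; punchOut-injective; injective⇒≤)
  renaming (_≟_ to _≟ᶠ_)
open import Data.Fin.Permutation using (Permutation′; permutation; _⟨$⟩ʳ_; _⟨$⟩ˡ_; inverseˡ)
open import Data.Product using (Σ; ∃; ∃₂; _×_; _,_; proj₁; proj₂)
open import Data.List using (List; []; _∷_; map; filter; length; allFin)
open import Data.List.Properties using (filter-≐)
open import Data.List.Membership.Propositional using (_∈_)
open import Data.List.Membership.Propositional.Properties using (∈-filter⁻)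
open import Data.List.Relation.Unary.Any using (here; there)
open import Data.List.Relation.Unary.AllPairs using (AllPairs; _∷_)
open import Data.List.Relation.Unary.All using ([]; _∷_)
import Data.List.Relation.Unary.AllPairs.Properties as AP
open import Relation.Unary using (_≐_)
open import Function using (_∘_)
open import Function.Bundles using (_⇔_; mk⇔)
open import Function.Definitions using (Injective)
open import Relation.Nullary using (¬_; Dec; yes; no; contradiction)
open import Data.Bool using (T; true; false)
open import Relation.Binary.PropositionalEquality

-- An injective endofunction of a finite set is onto: if it missed a value y,
-- composing with `punchOut` at y would inject Fin (suc m) into Fin m.
injective⇒surjective : ∀ {n} (f : Fin n → Fin n) → Injective _≡_ _≡_ f →
                       ∀ y → ∃ λ x → f x ≡ y
injective⇒surjective {zero}  f f-inj ()
injective⇒surjective {suc m} f f-inj y with any? (λ x → f x ≟ᶠ y)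
... | yes hit  = hit
... | no  miss = contradiction (injective⇒≤ squeezed-injective) 1+n≰n
  where
  squeezed : Fin (suc m) → Fin m
  squeezed x = punchOut (λ y≡fx → miss (x , sym y≡fx))

  squeezed-injective : Injective _≡_ _≡_ squeezed
  squeezed-injective eq = f-inj (punchOut-injective {i = y} _ _ eq)

injective⇒permutation : ∀ {n} (f : Fin n → Fin n) → Injective _≡_ _≡_ f →
                        Σ (Permutation′ n) λ π → ∀ x → π ⟨$⟩ˡ x ≡ f x
injective⇒permutation f f-inj = permutation g f g∘f f∘g , λ _ → refl
  where
  g : Fin _ → Fin _
  g y = proj₁ (injective⇒surjective f f-inj y)
  f∘g : ∀ y → f (g y) ≡ y
  f∘g y = proj₂ (injective⇒surjective f f-inj y)
  g∘f : ∀ x → g (f x) ≡ x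
  g∘f x = f-inj (f∘g (f x))

fin-index : ∀ {N k} → 1 ≤ k → k ≤ N → Σ (Fin N) λ x → k ≡ suc (toℕ x)
fin-index {k = suc k} _ k<N = fromℕ< k<N , cong suc (sym (toℕ-fromℕ< k<N))

at-suc : ∀ {N} (f : Fin N → Fin N) x → at f (suc (toℕ x)) ≡ suc (toℕ (f x))
at-suc {N} f x with toℕ x <? N
... | yes x<N = cong (λ y → suc (toℕ (f y))) (fromℕ<-toℕ x x<N)
... | no  x≮N = contradiction (toℕ<n x) x≮N

app-inverse : ∀ {N} (σ : Permutation′ N) {v} → 1 ≤ v → v ≤ N →
              (1 ≤ app σ v × app σ v ≤ N) × appInv σ (app σ v) ≡ v
app-inverse σ 1≤v v≤N with fin-index 1≤v v≤N
... | x , refl rewrite at-suc (σ ⟨$⟩ʳ_) x =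
  (s≤s z≤n , toℕ<n _) , trans (at-suc (σ ⟨$⟩ˡ_) _) (cong (suc ∘ toℕ) (inverseˡ σ))

word-permutation : ∀ N (w : ℕ → ℕ) →
  (∀ k → 1 ≤ k → k ≤ N → 1 ≤ w k × w k ≤ N) →
  (∀ {k k′} → 1 ≤ k → k ≤ N → 1 ≤ k′ → k′ ≤ N → w k ≡ w k′ → k ≡ k′) →
  Σ (Permutation′ N) λ σ → ∀ k → 1 ≤ k → k ≤ N → appInv σ k ≡ w k
word-permutation N w w-range w-injective = σ , σ⁻¹≡w
  where
  wᶠ-spec : ∀ x → Σ (Fin N) λ y → w (suc (toℕ x)) ≡ suc (toℕ y)
  wᶠ-spec x = let (lo , hi) = w-range (suc (toℕ x)) (s≤s z≤n) (toℕ<n x) in fin-index lo hi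

  wᶠ : Fin N → Fin N
  wᶠ x = proj₁ (wᶠ-spec x)

  wᶠ-injective : Injective _≡_ _≡_ wᶠ
  wᶠ-injective {x} {y} eq = toℕ-injective (suc-injective
    (w-injective (s≤s z≤n) (toℕ<n x) (s≤s z≤n) (toℕ<n y)
      (trans (proj₂ (wᶠ-spec x)) (trans (cong (suc ∘ toℕ) eq) (sym (proj₂ (wᶠ-spec y)))))))

  σ : Permutation′ N
  σ = proj₁ (injective⇒permutation wᶠ wᶠ-injective)

  σ⁻¹≡w : ∀ k → 1 ≤ k → k ≤ N → appInv σ k ≡ w k
  σ⁻¹≡w k 1≤k k≤N with fin-index 1≤k k≤N
  ... | x , refl = begin
    appInv σ (suc (toℕ x))   ≡⟨ at-suc (σ ⟨$⟩ˡ_) x ⟩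
    suc (toℕ (σ ⟨$⟩ˡ x))     ≡⟨ cong (suc ∘ toℕ) (proj₂ (injective⇒permutation wᶠ wᶠ-injective) x) ⟩
    suc (toℕ (wᶠ x))         ≡⟨ sym (proj₂ (wᶠ-spec x)) ⟩
    w (suc (toℕ x))          ∎
    where open ≡-Reasoning

-- In the word of σ⁻¹, the value v at position k is placed as Dumont requires:
-- an even value stands left of position v, an odd value right of it.
DumontPlaced : ℕ → ℕ → Set
DumontPlaced k v = ((∃ λ i → v ≡ 2 * i) → k < v) × ((∃ λ i → v ≡ suc (2 * i)) → v < k)

2[1+i]∸1≡1+2i : ∀ i → 2 * suc i ∸ 1 ≡ suc (2 * i)
2[1+i]∸1≡1+2i i = cong (_∸ 1) (*-suc 2 i)

-- σ is Dumont as soon as every value of the word σ⁻¹ is Dumont-placed: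
-- the value v sits at position σ(v).
dumont-from-inverse : ∀ m (σ : Permutation′ (2 * m)) →
  (∀ k → 1 ≤ k → k ≤ 2 * m → DumontPlaced k (appInv σ k)) → IsDumont m σ
dumont-from-inverse m σ placed (suc i) _ i≤m = even-left , odd-right
  where
  2i≤2m : 2 * suc i ≤ 2 * m
  2i≤2m = *-monoʳ-≤ 2 i≤m

  even-left : app σ (2 * suc i) < 2 * suc i
  even-left with app-inverse σ (s≤s z≤n) 2i≤2m
  ... | (lo , hi) , σ⁻¹σv≡v =
    subst (app σ (2 * suc i) <_) σ⁻¹σv≡v (proj₁ (placed _ lo hi) (suc i , σ⁻¹σv≡v))

  odd-right : 2 * suc i ∸ 1 < app σ (2 * suc i ∸ 1)
  odd-right rewrite 2[1+i]∸1≡1+2i i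
    with app-inverse σ (s≤s z≤n) (≤-trans (n≤1+n _) (subst (_≤ 2 * m) (*-suc 2 i) 2i≤2m))
  ... | (lo , hi) , σ⁻¹σv≡v =
    subst (_< app σ (suc (2 * i))) σ⁻¹σv≡v (proj₂ (placed _ lo hi) (i , σ⁻¹σv≡v))

even%2 : ∀ q → 2 * q % 2 ≡ 0
even%2 q = trans (cong (_% 2) (*-comm 2 q)) (m*n%n≡0 q 2)

odd%2 : ∀ q → suc (2 * q) % 2 ≡ 1
odd%2 q = trans (cong (λ t → suc t % 2) (*-comm 2 q)) ([m+kn]%n≡m%n 1 q 2)

even/2 : ∀ q → 2 * q / 2 ≡ q
even/2 q = trans (cong (_/ 2) (*-comm 2 q)) (m*n/n≡m q 2)

odd/2 : ∀ q → suc (2 * q) / 2 ≡ q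
odd/2 q = begin
  (1 + 2 * q) / 2      ≡⟨ +-distrib-/ 1 (2 * q) (subst (λ r → 1 + r < 2) (sym (even%2 q)) ≤-refl) ⟩
  0 + 2 * q / 2        ≡⟨ even/2 q ⟩
  q                    ∎
  where open ≡-Reasoning

odd<next-even : ∀ q → suc (2 * q) < 2 * suc q
odd<next-even q = ≤-reflexive (sym (*-suc 2 q))

T⇒≡true : ∀ {b} → T b → b ≡ true
T⇒≡true {true} _ = refl

¬T⇒≡false : ∀ {b} → ¬ T b → b ≡ false
¬T⇒≡false {false} _  = refl
¬T⇒≡false {true}  ¬t = contradiction _ ¬t

data RowView (n : ℕ) : ℕ → Set where
  lower-row : ∀ {r} → r ≤ n → RowView n r
  upper-row : ∀ q → RowView n (n + suc q)

rowView : ∀ n r → RowView n r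
rowView n r with r ≤? n
... | yes r≤n = lower-row r≤n
... | no  r≰n with m≤n⇒∃[o]m+o≡n (≰⇒> r≰n)
...   | q , refl = subst (RowView n) (+-suc n q) (upper-row q)

label-lower : ∀ {n r} → r ≤ n → label n r ≡ 2 * suc r
label-lower {n} {r} r≤n rewrite T⇒≡true (≤⇒≤ᵇ r≤n) =
  trans (+-comm (2 * r) 2) (sym (*-suc 2 r))

label-upper : ∀ n q → label n (n + suc q) ≡ suc (2 * q)
label-upper n q
  rewrite ¬T⇒≡false (m+1+n≰m n ∘ ≤ᵇ⇒≤ (n + suc q) n) | m+n∸m≡n n (suc q) =
  2[1+i]∸1≡1+2i q

-- Distinct rows have distinct labels (lower rows get even, upper rows odd labels).
label-injective : ∀ n {r r′} → label n r ≡ label n r′ → r ≡ r′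
label-injective n {r} {r′} eq with rowView n r | rowView n r′
... | lower-row r≤n | lower-row r′≤n =
  suc-injective (*-cancelˡ-≡ _ _ 2 (trans (sym (label-lower r≤n)) (trans eq (label-lower r′≤n))))
... | lower-row r≤n | upper-row q′ =
  contradiction (trans (sym (label-lower r≤n)) (trans eq (label-upper n q′))) (even≢odd (suc r) q′)
... | upper-row q | lower-row r′≤n =
  contradiction (trans (sym (label-lower r′≤n)) (trans (sym eq) (label-upper n q))) (even≢odd (suc r′) q)
... | upper-row q | upper-row q′ =
  cong (λ t → n + suc t) (*-cancelˡ-≡ _ _ 2
    (suc-injective (trans (sym (label-upper n q)) (trans eq (label-upper n q′)))))

label-range : ∀ n r → r ≤ n + suc n → 1 ≤ label n r × label n r ≤ 2 * suc n
label-range n r r≤2n+1 with rowView n r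
... | lower-row r≤n rewrite label-lower r≤n = s≤s z≤n , *-monoʳ-≤ 2 (s≤s r≤n)
... | upper-row q rewrite label-upper n q =
  s≤s z≤n , ≤-trans (<⇒≤ (odd<next-even q)) (*-monoʳ-≤ 2 (s≤s q≤n))
  where
  q≤n : q ≤ n
  q≤n = s≤s⁻¹ (+-cancelˡ-≤ n _ _ r≤2n+1)

label-dumont : ∀ n {c r k} → c ≤ r → r ≤ c + n → 2 * c ≤ k → k ≤ suc (2 * c) →
               DumontPlaced k (label n r)
label-dumont n {c} {r} {k} c≤r r≤c+n 2c≤k k≤2c+1 with rowView n r
... | lower-row r≤n rewrite label-lower r≤n =
  (λ _ → ≤-<-trans (≤-trans k≤2c+1 (s≤s (*-monoʳ-≤ 2 c≤r))) (odd<next-even r)) ,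
  (λ { (i , eq) → contradiction eq (even≢odd (suc r) i) })
... | upper-row q rewrite label-upper n q =
  (λ { (i , eq) → contradiction (sym eq) (even≢odd i q) }) ,
  (λ _ → <-≤-trans (odd<next-even q) (≤-trans (*-monoʳ-≤ 2 q<c) 2c≤k))
  where
  q<c : suc q ≤ c
  q<c = +-cancelˡ-≤ n _ _ (subst (n + suc q ≤_) (+-comm c n) r≤c+n)

-- For the two dots a < b of one column, the labels have equal parity exactly
-- when they increase: both lower or both upper rows give increasing labels of
-- equal parity, while a lower a and an upper b give an odd label below an even one.
label-normalized : ∀ n {j a b} → j ≤ a → a < b → b ≤ j + n →
  (label n b % 2 ≡ label n a % 2) ⇔ (label n a < label n b)
label-normalized n {j} {a} {b} j≤a a<b b≤j+n with rowView n a | rowView n b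
... | lower-row a≤n | lower-row b≤n
  rewrite label-lower a≤n | label-lower b≤n | even%2 (suc a) | even%2 (suc b) =
  mk⇔ (λ _ → *-monoʳ-< 2 (s≤s a<b)) (λ _ → refl)
... | lower-row a≤n | upper-row q
  rewrite label-lower a≤n | label-upper n q | even%2 (suc a) | odd%2 q =
  mk⇔ (λ ()) (λ a<q → contradiction a<q (<⇒≯ (<-≤-trans (odd<next-even q) (*-monoʳ-≤ 2 q<a))))
  where
  q<a : suc q ≤ suc a
  q<a = ≤-trans (+-cancelˡ-≤ n _ _ (subst (n + suc q ≤_) (+-comm j n) b≤j+n)) (≤-trans j≤a (n≤1+n a))
... | upper-row p | lower-row b≤n = contradiction (<-≤-trans a<b b≤n) (m+1+n≰m n ∘ <⇒≤)
... | upper-row p | upper-row q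
  rewrite label-upper n p | label-upper n q | odd%2 p | odd%2 q =
  mk⇔ (λ _ → s≤s (*-monoʳ-< 2 (s≤s⁻¹ (+-cancelˡ-< n _ _ a<b)))) (λ _ → refl)

-- Dot C j r: the configuration C has a dot in column j, row r (both 1-indexed).
-- Two virtual dots complete the picture: row 0 in column 0 and row 2n + 1 in
-- column n + 1; they carry the first and last letters 2 and 2n + 1 of the word.
data Dot {n} (C : DC n) : ℕ → ℕ → Set where
  bottom : Dot C 0 0
  top    : Dot C (suc n) (n + suc n)
  grid   : ∀ r → Dot C (suc (toℕ (col C r))) (suc (toℕ r))

grid-below-top : ∀ {n} (r : Fin (2 * n)) → suc (toℕ r) < n + suc n
grid-below-top {n} r =
  ≤-trans (s≤s (toℕ<n r)) (≤-reflexive (begin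
    suc (n + (n + 0))  ≡⟨ cong (λ t → suc (n + t)) (+-identityʳ n) ⟩
    suc (n + n)        ≡⟨ sym (+-suc n n) ⟩
    n + suc n          ∎))
  where open ≡-Reasoning

dot-bounds : ∀ {n} {C : DC n} {j r} → Dot C j r → j ≤ r × r ≤ j + n
dot-bounds {n} bottom = z≤n , z≤n
dot-bounds {n} top    = m≤n+m (suc n) n , ≤-reflexive (+-comm n (suc n))
dot-bounds {C = C} (grid r) = bounds C r

dot-row-bound : ∀ {n} {C : DC n} {j r} → Dot C j r → r ≤ n + suc n
dot-row-bound bottom   = z≤n
dot-row-bound top      = ≤-refl
dot-row-bound (grid r) = <⇒≤ (grid-below-top r)

dot-unique : ∀ {n} {C : DC n} {j j′ r r′} → Dot C j r → Dot C j′ r′ → r ≡ r′ → j ≡ j′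
dot-unique bottom   bottom    _  = refl
dot-unique {n} bottom top     eq = contradiction (trans eq (+-suc n n)) λ ()
dot-unique bottom   (grid _)  ()
dot-unique {n} top  bottom    eq = contradiction (trans (sym eq) (+-suc n n)) λ ()
dot-unique top      top       _  = refl
dot-unique top      (grid r′) eq = contradiction (sym eq) (<⇒≢ (grid-below-top r′))
dot-unique (grid _) bottom    ()
dot-unique (grid r) top       eq = contradiction eq (<⇒≢ (grid-below-top r))
dot-unique {C = C} (grid r) (grid r′) eq = cong (suc ∘ toℕ ∘ col C) (toℕ-injective (suc-injective eq))

length≡2 : ∀ {A : Set} (xs : List A) → length xs ≡ 2 → ∃₂ λ x y → xs ≡ x ∷ y ∷ []
length≡2 (x ∷ y ∷ []) refl = x , y , refl

record ColumnDots {n} (C : DC n) (j : ℕ) : Set where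
  field
    lower-dot   : Dot C j (i₁ C j)
    upper-dot   : Dot C j (i₂ C j)
    lower<upper : i₁ C j < i₂ C j
open ColumnDots

column : ∀ {n} (C : DC n) {j} → 1 ≤ j → j ≤ n → ColumnDots C j
column {n} C {suc j} _ j<n = from-pair (length≡2 rows rows-length)
  where
  in-column? : ∀ r → Dec (suc (toℕ (col C r)) ≡ suc j)
  in-column? r = suc (toℕ (col C r)) ≟ suc j

  rows : List (Fin (2 * n))
  rows = filter in-column? (allFin (2 * n))

  rows-length : length rows ≡ 2
  rows-length =
    trans (cong length (filter-≐ in-column? (λ r → toℕ (col C r) ≟ toℕ c) same-test (allFin (2 * n))))
          (twoDots C c)
    where
    c : Fin n
    c = fromℕ< j<n
    same-test : (λ r → suc (toℕ (col C r)) ≡ suc j) ≐ (λ r → toℕ (col C r) ≡ toℕ c)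
    same-test = (λ e → trans (suc-injective e) (sym (toℕ-fromℕ< j<n)))
              , (λ e → cong suc (trans e (toℕ-fromℕ< j<n)))

  rows-increasing : AllPairs Fin._<_ rows
  rows-increasing = AP.filter⁺ in-column? (AP.tabulate⁺-< (λ i<j → i<j))

  from-pair : ∃₂ (λ x y → rows ≡ x ∷ y ∷ []) → ColumnDots C (suc j)
  from-pair (x , y , rows≡xy) = record
    { lower-dot   = subst (Dot C (suc j)) (sym (cong (nthOr0 0 ∘ rowNumbers) rows≡xy))
                          (dot-in-column x (here refl))
    ; upper-dot   = subst (Dot C (suc j)) (sym (cong (nthOr0 1 ∘ rowNumbers) rows≡xy))
                          (dot-in-column y (there (here refl)))
    ; lower<upper = subst (λ l → nthOr0 0 (rowNumbers l) < nthOr0 1 (rowNumbers l))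
                          (sym rows≡xy) (s≤s x<y)
    }
    where
    rowNumbers : List (Fin (2 * n)) → List ℕ
    rowNumbers = map (suc ∘ toℕ)

    x<y : x Fin.< y
    x<y with subst (AllPairs Fin._<_) rows≡xy rows-increasing
    ... | (x<y ∷ []) ∷ _ = x<y

    dot-in-column : ∀ r → r ∈ x ∷ y ∷ [] → Dot C (suc j) (suc (toℕ r))
    dot-in-column r r∈ = subst (λ c → Dot C c (suc (toℕ r)))
      (proj₂ (∈-filter⁻ in-column? {xs = allFin _} (subst (r ∈_) (sym rows≡xy) r∈))) (grid r)

data Halves : ℕ → Set where
  even : ∀ q → Halves (2 * q)
  odd  : ∀ q → Halves (suc (2 * q))

halves : ∀ k → Halves k
halves zero = even 0
halves (suc k) with halves k
... | even q = odd q
... | odd  q = subst Halves (*-suc 2 q) (even (suc q))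

-- The positions 1 .. 2n + 2 of the word φ(C)⁻¹: the first and last letters, and
-- for each column j ∈ [1, n] the positions 2j and 2j + 1 carrying the labels of
-- its upper and lower dot.
data Position (n : ℕ) : ℕ → Set where
  first : Position n 1
  upper : ∀ {j} → 1 ≤ j → j ≤ n → Position n (2 * j)
  lower : ∀ {j} → 1 ≤ j → j ≤ n → Position n (suc (2 * j))
  last  : Position n (2 * suc n)

position : ∀ n {k} → 1 ≤ k → k ≤ 2 * suc n → Position n k
position n {k} 1≤k k≤N with halves k
... | even zero    = contradiction 1≤k λ ()
... | odd  zero    = first
... | odd  (suc j) = lower (s≤s z≤n) (s≤s⁻¹ (*-cancelˡ-< 2 (suc j) (suc n) k≤N))
... | even (suc j) with suc j ≟ suc n
...   | yes refl = last
...   | no  j≢n  = upper (s≤s z≤n) (s≤s⁻¹ (≤∧≢⇒< (*-cancelˡ-≤ 2 k≤N) j≢n))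

position-range : ∀ {n k} → Position n k → 1 ≤ k × k ≤ 2 * suc n
position-range first                 = ≤-refl , s≤s z≤n
position-range (upper {suc _} _ j≤n) = s≤s z≤n , *-monoʳ-≤ 2 (m≤n⇒m≤1+n j≤n)
position-range (lower _ j≤n)         = s≤s z≤n , *-monoʳ-< 2 (s≤s j≤n)
position-range last                  = s≤s z≤n , ≤-refl

columnAt : ∀ {n k} → Position n k → ℕ
columnAt first           = 0
columnAt (upper {j} _ _) = j
columnAt (lower {j} _ _) = j
columnAt {n} last        = suc n

rowAt : ∀ {n k} → DC n → Position n k → ℕ
rowAt C first           = 0
rowAt C (upper {j} _ _) = i₂ C j
rowAt C (lower {j} _ _) = i₁ C j
rowAt {n} C last        = n + suc n

dotAt : ∀ {n k} (C : DC n) (p : Position n k) → Dot C (columnAt p) (rowAt C p)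
dotAt C first               = bottom
dotAt C (upper 1≤j j≤n)     = upper-dot (column C 1≤j j≤n)
dotAt C (lower 1≤j j≤n)     = lower-dot (column C 1≤j j≤n)
dotAt C last                = top

columnAt-position : ∀ {n k} (p : Position n k) → 2 * columnAt p ≤ k × k ≤ suc (2 * columnAt p)
columnAt-position first       = z≤n , ≤-refl
columnAt-position (upper _ _) = ≤-refl , n≤1+n _
columnAt-position (lower _ _) = n≤1+n _ , ≤-refl
columnAt-position last        = ≤-refl , n≤1+n _

≡ᵇ-refl : ∀ m → (m ≡ᵇ m) ≡ true
≡ᵇ-refl m = T⇒≡true (≡⇒≡ᵇ m m refl)

≢⇒≡ᵇ-false : ∀ {m k} → m ≢ k → (m ≡ᵇ k) ≡ false
≢⇒≡ᵇ-false {m} {k} m≢k = ¬T⇒≡false (m≢k ∘ ≡ᵇ⇒≡ m k)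

word-at : ∀ {n k} (C : DC n) (p : Position n k) → phiInvWord C k ≡ label n (rowAt C p)
word-at C first = refl
word-at {n} C (upper {j} _ j≤n)
  rewrite ≢⇒≡ᵇ-false {2 * j} {1} (even≢odd j 0)
        | ≢⇒≡ᵇ-false {2 * j} {2 * suc n} (λ e → 1+n≰n (subst (_≤ n) (*-cancelˡ-≡ _ _ 2 e) j≤n))
        | even%2 j | even/2 j = refl
word-at {n} C (lower {suc j} _ _)
  rewrite ≢⇒≡ᵇ-false {suc (2 * suc j)} {2 * suc n} (even≢odd (suc n) (suc j) ∘ sym)
        | odd%2 (suc j) | odd/2 (suc j) = refl
word-at {n} C last
  rewrite ≢⇒≡ᵇ-false {2 * suc n} {1} (even≢odd (suc n) 0) | ≡ᵇ-refl (2 * suc n) =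
  trans (+-comm (2 * n) 1) (sym (label-upper n n))

word-range : ∀ {n} (C : DC n) k → 1 ≤ k → k ≤ 2 * suc n →
             1 ≤ phiInvWord C k × phiInvWord C k ≤ 2 * suc n
word-range {n} C k 1≤k k≤N = subst (λ v → 1 ≤ v × v ≤ 2 * suc n) (sym (word-at C p))
                                   (label-range n _ (dot-row-bound (dotAt C p)))
  where
  p : Position n k
  p = position n 1≤k k≤N

-- A position is determined by the dot it reads: the column fixes the pair
-- 2c, 2c + 1, and the two dots of a column lie in different rows.
same-dot⇒same-position : ∀ {n k k′} (C : DC n) (p : Position n k) (p′ : Position n k′) →
  columnAt p ≡ columnAt p′ → rowAt C p ≡ rowAt C p′ → k ≡ k′
same-dot⇒same-position C first       first         _  _ = refl
same-dot⇒same-position C first       (upper 1≤j _) c  _ = contradiction c (<⇒≢ 1≤j)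
same-dot⇒same-position C first       (lower 1≤j _) c  _ = contradiction c (<⇒≢ 1≤j)
same-dot⇒same-position C first       last          () _
same-dot⇒same-position C (upper 1≤j _) first       c  _ = contradiction (sym c) (<⇒≢ 1≤j)
same-dot⇒same-position C (upper _ _) (upper _ _)   refl _ = refl
same-dot⇒same-position C (upper 1≤j j≤n) (lower _ _) refl r =
  contradiction (sym r) (<⇒≢ (lower<upper (column C 1≤j j≤n)))
same-dot⇒same-position {n} C (upper _ j≤n) last    c  _ = contradiction (subst (_≤ n) c j≤n) 1+n≰n
same-dot⇒same-position C (lower 1≤j _) first       c  _ = contradiction (sym c) (<⇒≢ 1≤j)
same-dot⇒same-position C (lower 1≤j j≤n) (upper _ _) refl r =
  contradiction r (<⇒≢ (lower<upper (column C 1≤j j≤n)))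
same-dot⇒same-position C (lower _ _) (lower _ _)   refl _ = refl
same-dot⇒same-position {n} C (lower _ j≤n) last    c  _ = contradiction (subst (_≤ n) c j≤n) 1+n≰n
same-dot⇒same-position C last        first         () _
same-dot⇒same-position {n} C last (upper _ j≤n)    c  _ = contradiction (subst (_≤ n) (sym c) j≤n) 1+n≰n
same-dot⇒same-position {n} C last (lower _ j≤n)    c  _ = contradiction (subst (_≤ n) (sym c) j≤n) 1+n≰n
same-dot⇒same-position C last        last          _  _ = refl

word-injective : ∀ {n} (C : DC n) {k k′} → 1 ≤ k → k ≤ 2 * suc n → 1 ≤ k′ → k′ ≤ 2 * suc n →
                 phiInvWord C k ≡ phiInvWord C k′ → k ≡ k′
word-injective {n} C 1≤k k≤N 1≤k′ k′≤N eq =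
  same-dot⇒same-position C p p′ (dot-unique (dotAt C p) (dotAt C p′) same-row) same-row
  where
  p : Position n _
  p = position n 1≤k k≤N
  p′ : Position n _
  p′ = position n 1≤k′ k′≤N
  same-row : rowAt C p ≡ rowAt C p′
  same-row = label-injective n (trans (sym (word-at C p)) (trans eq (word-at C p′)))

word-placed : ∀ {n} (C : DC n) k → 1 ≤ k → k ≤ 2 * suc n → DumontPlaced k (phiInvWord C k)
word-placed {n} C k 1≤k k≤N = subst (DumontPlaced k) (sym (word-at C p))
  (label-dumont n (proj₁ (dot-bounds (dotAt C p))) (proj₂ (dot-bounds (dotAt C p)))
                  (proj₁ (columnAt-position p)) (proj₂ (columnAt-position p)))
  where
  p : Position n k
  p = position n 1≤k k≤N

normalized-dumont : ∀ {n} (C : DC n) (σ : Permutation′ (2 * suc n)) →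
  (∀ k → 1 ≤ k → k ≤ 2 * suc n → appInv σ k ≡ phiInvWord C k) → IsNormalizedDumont (suc n) σ
normalized-dumont {n} C σ σ⁻¹≡word = dumont , normalized
  where
  at-position : ∀ {k} → Position n k → appInv σ k ≡ phiInvWord C k
  at-position p = σ⁻¹≡word _ (proj₁ (position-range p)) (proj₂ (position-range p))

  dumont : IsDumont (suc n) σ
  dumont = dumont-from-inverse (suc n) σ λ k 1≤k k≤N →
    subst (DumontPlaced k) (sym (σ⁻¹≡word k 1≤k k≤N)) (word-placed C k 1≤k k≤N)

  normalized : ∀ j → 1 ≤ j → j ≤ n →
    (appInv σ (2 * j) % 2 ≡ appInv σ (2 * j + 1) % 2) ⇔ (appInv σ (2 * j + 1) < appInv σ (2 * j))
  normalized j 1≤j j≤n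
    rewrite +-comm (2 * j) 1
          | at-position (upper 1≤j j≤n) | word-at C (upper 1≤j j≤n)
          | at-position (lower 1≤j j≤n) | word-at C (lower 1≤j j≤n) =
    label-normalized n (proj₁ (dot-bounds (lower-dot dots))) (lower<upper dots)
                       (proj₂ (dot-bounds (upper-dot dots)))
    where
    dots : ColumnDots C j
    dots = column C 1≤j j≤n

proposition2 : (n : ℕ) → 1 ≤ n → (C : DC n) →
    Σ (Permutation′ (2 * suc n)) λ φC →
      (∀ k → 1 ≤ k → k ≤ 2 * suc n → appInv φC k ≡ phiInvWord C k)
      × IsNormalizedDumont (suc n) φC
proposition2 n _ C = φC , φC⁻¹≡word , normalized-dumont C φC φC⁻¹≡word
  where
  φC : Permutation′ (2 * suc n)
  φC = proj₁ (word-permutation (2 * suc n) (phiInvWord C) (word-range C) (word-injective C))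

  φC⁻¹≡word : ∀ k → 1 ≤ k → k ≤ 2 * suc n → appInv φC k ≡ phiInvWord C k
  φC⁻¹≡word = proj₂ (word-permutation (2 * suc n) (phiInvWord C) (word-range C) (word-injective C))
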